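{- For each quotient-component $\underline C$ of $\underline\Gamma$, the probability distribution $\pi_{\underline C}(\underline u)=\mathrm{LP}(\underline u)\mathrm{RP}(\underline u)/K_{\underline C}$ ($\underline u\in\underline C$), with $K_{\underline C}=|\mathcal P_{\mathrm R\to\mathrm L}(\underline C)|\cdot(\mathbb E_{\underline C}[\mathrm{len}(\eta)]+1)$, satisfies the reversibility (detailed balance) condition for the induced root-to-leaf path random walk on $\underline\Gamma$; consequently it is the stationary distribution associated with $\underline C$.
   Context: A double cover of a graded signed graph is $\Gamma=(X,E,[\cdot:\cdot],\dim,-)$: $X$ finite nonempty, $E$ directed edges ($u\subset v$), signature $[v:u]\in\{\pm1\}$, $\dim:X\to\mathbb Z$, $-$ a fixed-point-free involution, with $u\subset v\Rightarrow\dim u<\dim v$, $-u\subset v$, $u\subset-v$, $[-v:u]=[v:-u]=-[v:u]$, and $\dim(-u)=\dim u$. Quotient $\underline\Gamma$: nodes $\underline u=\{u,-u\}$, edges $\underline u\subset\underline v$ iff $u\subset v$. Leaf: no $\underline v\supset\underline u$; root: no $\underline t\subset\underline u$. $\mathrm{LP}=1$ on leaves, $\sum_{\underline v\supset\underline u}\mathrm{LP}(\underline v)$ otherwise; $\mathrm{RP}=1$ on roots, $\sum_{\underline t\subset\underline u}\mathrm{RP}(\underline t)$ otherwise. The induced walk on $\underline\Gamma$ has $P(\underline u,\underline u')=\frac12\mathrm{LP}(\underline u')/\mathrm{LP}(\underline u)$ if $\underline u\subset\underline u'$; $\frac12\mathrm{RP}(\underline u')/\mathrm{RP}(\underline u)$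 if $\underline u'\subset\underline u$; $1/2$ if $\underline u=\underline u'$ is exactly one of leaf/root; $1$ if $\underline u=\underline u'$ is both; $0$ otherwise. A quotient-component is a connected component of the undirected graph underlying $\underline\Gamma$. $\mathcal P_{\mathrm R\to\mathrm L}(\underline C)$ is the set of root-to-leaf paths in $\underline C$, i.e. sequences $\underline w_0\subset\dots\subset\underline w_n$ in $\underline C$ from a root to a leaf ($n=\mathrm{len}(\eta)\ge0$), and $\mathbb E_{\underline C}[\mathrm{len}(\eta)]$ is the expected length of a uniformly random such path. -}

module Defs where

open import Data.Nat as ℕ using (ℕ; zero; suc; _<ᵇ_)
open import Data.Nat.ListAction using () renaming (sum to ℕsum)
open import Data.Integer as ℤ using (ℤ; +_)
open import Data.Rational as ℚ using (ℚ; 0ℚ; 1ℚ)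
open import Data.Rational.Properties as ℚP using ()
open import Data.Fin as Fin using (Fin; toℕ)
open import Data.Sign using (Sign; opposite)
open import Data.Bool using (Bool; true; false; _∧_; _∨_; if_then_else_; not)
open import Data.List as List using (List; []; _∷_; filter; map; concatMap; length; allFin; null; foldr)
open import Data.Product using (Σ; _×_; _,_)
open import Relation.Binary.PropositionalEquality using (_≡_; _≢_)
open import Relation.Nullary using (yes; no; ⌊_⌋)
open import Relation.Nullary.Decidable using (does)

-- Double cover of a graded signed graph on the finite set X = Fin n.
-- sub u v = true  encodes the directed edge  u ⊂ v  (u,v) ∈ E.
-- sig v u encodes the signature [v:u] ∈ {±1} (meaningful on edges).

record DoubleCover (n : ℕ) : Set where
  field
    X-nonempty : Fin n
    sub    : Fin n → Fin n → Bool
    sig    : Fin n → Fin n → Sign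
    dim    : Fin n → ℤ
    neg    : Fin n → Fin n
    neg-invol   : ∀ u → neg (neg u) ≡ u
    neg-nofix   : ∀ u → neg u ≢ u
    dim-mono    : ∀ u v → sub u v ≡ true → dim u ℤ.< dim v
    sub-negˡ    : ∀ u v → sub u v ≡ true → sub (neg u) v ≡ true
    sub-negʳ    : ∀ u v → sub u v ≡ true → sub u (neg v) ≡ true
    sig-negˡ    : ∀ u v → sub u v ≡ true → sig (neg v) u ≡ opposite (sig v u)
    sig-negʳ    : ∀ u v → sub u v ≡ true → sig v (neg u) ≡ opposite (sig v u)
    dim-neg     : ∀ u → dim (neg u) ≡ dim u

qsum : List ℚ → ℚ
qsum = foldr ℚ._+_ 0ℚ

-- a / b as a rational (b = 0 never occurs where used; returns 0 then)
frac : ℕ → ℕ → ℚ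
frac a zero    = 0ℚ
frac a (suc b) = (+ a) ℚ./ suc b

-- p / q in ℚ (q = 0 never occurs where used; returns 0 then)
qdiv : ℚ → ℚ → ℚ
qdiv p q with q ℚP.≟ 0ℚ
... | yes _  = 0ℚ
... | no q≢0 = ℚ._÷_ p q {{ℚ.≢-nonZero q≢0}}

half : ℚ
half = frac 1 2

-- The quotient graph.  A quotient node {u , -u} is represented by its
-- canonical representative: the element with the smaller index.

module Quotient {n : ℕ} (Γ : DoubleCover n) where
  open DoubleCover Γ

  canon : Fin n → Bool
  canon u = toℕ u <ᵇ toℕ (neg u)

  qnodes : List (Fin n)
  qnodes = filter (λ u → canon u Data.Bool.≟ true) (allFin n)

  sameQ : Fin n → Fin n → Bool
  sameQ u u' = does (u Fin.≟ u') ∨ does (u' Fin.≟ neg u)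

  ups : Fin n → List (Fin n)
  ups u = filter (λ v → sub u v Data.Bool.≟ true) qnodes

  downs : Fin n → List (Fin n)
  downs u = filter (λ t → sub t u Data.Bool.≟ true) qnodes

  isLeaf : Fin n → Bool
  isLeaf u = null (ups u)

  isRoot : Fin n → Bool
  isRoot u = null (downs u)

  -- LP / RP by the recursive definitions; fuel n suffices since chains
  -- in the quotient have fewer than n nodes (dim strictly increases).
  LPf : ℕ → Fin n → ℕ
  LPf zero    u = 1
  LPf (suc k) u = if isLeaf u then 1 else ℕsum (map (LPf k) (ups u))

  RPf : ℕ → Fin n → ℕ
  RPf zero    u = 1
  RPf (suc k) u = if isRoot u then 1 else ℕsum (map (RPf k) (downs u))

  LP : Fin n → ℕ
  LP = LPf n

  RP : Fin n → ℕ
  RP = RPf n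

  P : Fin n → Fin n → ℚ
  P u u' =
    if sub u u' then half ℚ.* frac (LP u') (LP u)
    else if sub u' u then half ℚ.* frac (RP u') (RP u)
    else if sameQ u u'
      then (if isLeaf u ∧ isRoot u then 1ℚ
            else if isLeaf u ∨ isRoot u then half else 0ℚ)
    else 0ℚ

  adj : Fin n → Fin n → Bool
  adj x y = sub x y ∨ sub y x

  data Conn : Fin n → Fin n → Set where
    conn-refl : ∀ {x} → Conn x x
    conn-step : ∀ {x y z} → Conn x y → adj y z ≡ true → Conn x z

  -- C (a boolean predicate on quotient nodes, i.e. on canonical
  -- representatives) is a connected component of the quotient graph
  IsComponent : (Fin n → Bool) → Set
  IsComponent C =
    (∀ x → C x ≡ true → canon x ≡ true)
    × Σ (Fin n) (λ c → C c ≡ true)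
    × (∀ x y → C x ≡ true → canon y ≡ true → adj x y ≡ true → C y ≡ true)
    × (∀ x y → C x ≡ true → C y ≡ true → Conn x y)

  pathsF : ℕ → Fin n → List (List (Fin n))
  pathsF zero    u = []
  pathsF (suc k) u =
    if isLeaf u then (u ∷ []) ∷ []
    else concatMap (λ v → map (u ∷_) (pathsF k v)) (ups u)

  rootLeafPaths : (Fin n → Bool) → List (List (Fin n))
  rootLeafPaths C =
    concatMap (pathsF n) (filter (λ r → (C r ∧ isRoot r) Data.Bool.≟ true) qnodes)

  len : List (Fin n) → ℕ
  len η = length η ℕ.∸ 1

  expectedLen : (Fin n → Bool) → ℚ
  expectedLen C =
    frac (ℕsum (map len (rootLeafPaths C))) (length (rootLeafPaths C))

  K : (Fin n → Bool) → ℚ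
  K C = frac (length (rootLeafPaths C)) 1 ℚ.* (expectedLen C ℚ.+ 1ℚ)

  π : (Fin n → Bool) → Fin n → ℚ
  π C u = if C u then qdiv (frac (LP u ℕ.* RP u) 1) (K C) else 0ℚ

module Submission where

-- LP(u)·RP(u) is the number of root-to-leaf paths through u, so summing it over the component
-- counts every node of every root-to-leaf path once: Σ LP·RP = Σ_η (len η + 1) = K_C, and π_C
-- is a probability distribution.  Along an edge u ⊂ u′ both π(u)P(u,u′) and π(u′)P(u′,u) equal
-- RP(u)·LP(u′)/(2K_C), which is detailed balance.  Each row of P sums to 1, because the halves
-- that cannot move up (at a leaf) or down (at a root) stay on the self-loop; detailed balance
-- and these row sums give stationarity.

open import Defs
open import Data.Nat using (ℕ)
open import Data.Fin using (Fin)
open import Data.Bool using (Bool; true)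
open import Data.List using (map)
open import Data.Product using (_×_)
open import Data.Rational using (_*_; _≤_; 0ℚ; 1ℚ)
open import Relation.Binary.PropositionalEquality using (_≡_)

open import Algebra.Structures using (IsCommutativeSemiring; IsCommutativeRing)
open import Data.Bool as Bool using (false; if_then_else_; _∧_; _∨_)
import Data.Bool.Properties as BoolP
open BoolP using (¬-not)
open import Data.Empty using (⊥-elim)
open import Data.Fin as Fin using (toℕ)
import Data.Fin.Properties as FinP
open import Data.Integer as ℤ using (ℤ; +_)
import Data.Integer.Properties as ℤP
open import Data.List as List using (List; []; _∷_; _++_; foldr; filter; concatMap; length; null)
import Data.List.Properties as ListP
open import Data.List.Membership.Propositional using (_∈_)
open import Data.List.Membership.Propositional.Properties
  using (∈-filter⁻; ∈-filter⁺; ∈-allFin; ∈-concatMap⁻; ∈-map⁻)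
import Data.List.Relation.Unary.All as All
open import Data.List.Relation.Unary.Any using (here; there; satisfied)
open import Data.Nat as ℕ using (zero; suc; NonZero; s≤s)
import Data.Nat.Properties as ℕP
open import Data.Nat.ListAction using () renaming (sum to ℕsum)
open import Data.Nat.Solver using (module +-*-Solver)
open import Data.Product using (_,_; proj₂)
open import Data.Rational as ℚ using (ℚ)
import Data.Rational.Properties as ℚP
import Data.Rational.Solver as ℚS
open import Data.Rational.Unnormalised as ℚᵘ using (mkℚᵘ; *≡*) renaming (_≃_ to _≃ᵘ_)
import Data.Rational.Unnormalised.Properties as ℚᵘP
open import Function using (_∘_; id)
open import Function.Bundles using (Equivalence)
open import Relation.Binary.PropositionalEquality
  using (_≢_; refl; sym; trans; cong; cong₂; subst; ≢-sym; module ≡-Reasoning)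
open import Relation.Nullary using (¬_; Dec; yes; no; does; contradiction)
open import Relation.Nullary.Decidable using (dec-false)

module SemiringSum {A : Set} {_⊕_ _⊛_ : A → A → A} {0# 1# : A}
  (isCS : IsCommutativeSemiring _≡_ _⊕_ _⊛_ 0# 1#) where

  open IsCommutativeSemiring isCS
    using (+-assoc; +-comm; +-identityˡ; distribˡ; distribʳ; zeroˡ; zeroʳ)

  sum : List A → A
  sum = foldr _⊕_ 0#

  sum-++ : ∀ xs ys → sum (xs ++ ys) ≡ sum xs ⊕ sum ys
  sum-++ []       ys = sym (+-identityˡ (sum ys))
  sum-++ (x ∷ xs) ys = trans (cong (x ⊕_) (sum-++ xs ys)) (sym (+-assoc x (sum xs) (sum ys)))

  sum-map-0 : ∀ {B : Set} (xs : List B) → sum (map (λ _ → 0#) xs) ≡ 0#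
  sum-map-0 []       = refl
  sum-map-0 (x ∷ xs) = trans (+-identityˡ _) (sum-map-0 xs)

  sum-map-+ : ∀ {B : Set} (f g : B → A) xs →
              sum (map (λ x → f x ⊕ g x) xs) ≡ sum (map f xs) ⊕ sum (map g xs)
  sum-map-+ f g []       = sym (+-identityˡ 0#)
  sum-map-+ f g (x ∷ xs) = begin
    (f x ⊕ g x) ⊕ sum (map (λ x → f x ⊕ g x) xs) ≡⟨ cong ((f x ⊕ g x) ⊕_) (sum-map-+ f g xs) ⟩
    (f x ⊕ g x) ⊕ (F ⊕ G)                         ≡⟨ +-assoc (f x) (g x) (F ⊕ G) ⟩
    f x ⊕ (g x ⊕ (F ⊕ G))                         ≡⟨ cong (f x ⊕_) (sym (+-assoc (g x) F G)) ⟩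
    f x ⊕ ((g x ⊕ F) ⊕ G)                         ≡⟨ cong (λ y → f x ⊕ (y ⊕ G)) (+-comm (g x) F) ⟩
    f x ⊕ ((F ⊕ g x) ⊕ G)                         ≡⟨ cong (f x ⊕_) (+-assoc F (g x) G) ⟩
    f x ⊕ (F ⊕ (g x ⊕ G))                         ≡⟨ sym (+-assoc (f x) F (g x ⊕ G)) ⟩
    (f x ⊕ F) ⊕ (g x ⊕ G)                         ∎
    where
    open ≡-Reasoning
    F = sum (map f xs)
    G = sum (map g xs)

  sum-map-*ˡ : ∀ {B : Set} c (f : B → A) xs → sum (map (λ x → c ⊛ f x) xs) ≡ c ⊛ sum (map f xs)
  sum-map-*ˡ c f []       = sym (zeroʳ c)
  sum-map-*ˡ c f (x ∷ xs) =
    trans (cong ((c ⊛ f x) ⊕_) (sum-map-*ˡ c f xs)) (sym (distribˡ c (f x) (sum (map f xs))))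

  sum-map-*ʳ : ∀ {B : Set} c (f : B → A) xs → sum (map (λ x → f x ⊛ c) xs) ≡ sum (map f xs) ⊛ c
  sum-map-*ʳ c f []       = sym (zeroˡ c)
  sum-map-*ʳ c f (x ∷ xs) =
    trans (cong ((f x ⊛ c) ⊕_) (sum-map-*ʳ c f xs)) (sym (distribʳ c (f x) (sum (map f xs))))

  sum-filter : ∀ {B : Set} (p : B → Bool) (g : B → A) xs →
               sum (map g (filter (λ x → p x Bool.≟ true) xs))
                 ≡ sum (map (λ x → if p x then g x else 0#) xs)
  sum-filter p g []       = refl
  sum-filter p g (x ∷ xs) with p x
  ... | true  = cong (g x ⊕_) (sum-filter p g xs)
  ... | false = trans (sum-filter p g xs) (sym (+-identityˡ _))

  sum-if : ∀ {B : Set} b (h : B → A) xs →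
           (if b then sum (map h xs) else 0#) ≡ sum (map (λ x → if b then h x else 0#) xs)
  sum-if true  h xs = refl
  sum-if false h xs = sym (sum-map-0 xs)

  sum-if-filter : ∀ {B : Set} b (p : B → Bool) (g : B → A) xs →
                  (if b then sum (map g (filter (λ x → p x Bool.≟ true) xs)) else 0#)
                    ≡ sum (map (λ x → if b then (if p x then g x else 0#) else 0#) xs)
  sum-if-filter b p g xs = trans (cong (λ s → if b then s else 0#) (sum-filter p g xs)) (sum-if b _ xs)

  sum-swap : ∀ {B C : Set} (H : B → C → A) xs ys →
             sum (map (λ x → sum (map (H x) ys)) xs) ≡ sum (map (λ y → sum (map (λ x → H x y) xs)) ys)
  sum-swap H []       ys = sym (sum-map-0 ys)
  sum-swap H (x ∷ xs) ys =
    trans (cong (sum (map (H x) ys) ⊕_) (sum-swap H xs ys))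
          (sym (sum-map-+ (H x) (λ y → sum (map (λ x → H x y) xs)) ys))

  sum-concatMap : ∀ {B C : Set} (g : C → A) (f : B → List C) xs →
                  sum (map g (concatMap f xs)) ≡ sum (map (λ x → sum (map g (f x))) xs)
  sum-concatMap g f []       = refl
  sum-concatMap g f (x ∷ xs) = begin
    sum (map g (f x ++ concatMap f xs))
      ≡⟨ cong sum (ListP.map-++ g (f x) (concatMap f xs)) ⟩
    sum (map g (f x) ++ map g (concatMap f xs))
      ≡⟨ sum-++ (map g (f x)) _ ⟩
    sum (map g (f x)) ⊕ sum (map g (concatMap f xs))
      ≡⟨ cong (sum (map g (f x)) ⊕_) (sum-concatMap g f xs) ⟩
    sum (map g (f x)) ⊕ sum (map (λ x → sum (map g (f x))) xs) ∎
    where open ≡-Reasoning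

module ℕΣ = SemiringSum ℕP.+-*-isCommutativeSemiring
module ℚΣ = SemiringSum (IsCommutativeRing.isCommutativeSemiring ℚP.+-*-isCommutativeRing)

null⇒≡[] : ∀ {A : Set} {xs : List A} → null xs ≡ true → xs ≡ []
null⇒≡[] {xs = []} _ = refl

length-concatMap : ∀ {A B : Set} (f : A → List B) xs →
                   length (concatMap f xs) ≡ ℕsum (map (length ∘ f) xs)
length-concatMap f []       = refl
length-concatMap f (x ∷ xs) =
  trans (ListP.length-++ (f x)) (cong (length (f x) ℕ.+_) (length-concatMap f xs))

sum-map-suc : ∀ {A : Set} (f : A → ℕ) xs → ℕsum (map (suc ∘ f) xs) ≡ ℕsum (map f xs) ℕ.+ length xs
sum-map-suc f []       = refl
sum-map-suc f (x ∷ xs) = begin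
  suc (f x ℕ.+ ℕsum (map (suc ∘ f) xs))          ≡⟨ cong (λ s → suc (f x ℕ.+ s)) (sum-map-suc f xs) ⟩
  suc (f x ℕ.+ (ℕsum (map f xs) ℕ.+ length xs))  ≡⟨ cong suc (sym (ℕP.+-assoc (f x) _ _)) ⟩
  suc (f x ℕ.+ ℕsum (map f xs) ℕ.+ length xs)    ≡⟨ sym (ℕP.+-suc _ _) ⟩
  f x ℕ.+ ℕsum (map f xs) ℕ.+ suc (length xs)    ∎
  where open ≡-Reasoning

sum-pos : ∀ {A : Set} (f : A → ℕ) xs → null xs ≡ false → (∀ x → 0 ℕ.< f x) → 0 ℕ.< ℕsum (map f xs)
sum-pos f (x ∷ xs) _ pos = ℕP.<-≤-trans (pos x) (ℕP.m≤m+n (f x) _)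

∈⇒≤sum : ∀ {A : Set} (f : A → ℕ) {x xs} → x ∈ xs → f x ℕ.≤ ℕsum (map f xs)
∈⇒≤sum f {xs = y ∷ _}  (here refl) = ℕP.m≤m+n (f y) _
∈⇒≤sum f {xs = y ∷ _}  (there x∈) = ℕP.≤-trans (∈⇒≤sum f x∈) (ℕP.m≤n+m _ (f y))

map-allFin-suc : ∀ {A : Set} {k} (f : Fin (suc k) → A) →
                 map f (List.allFin (suc k)) ≡ f Fin.zero ∷ map (f ∘ Fin.suc) (List.allFin k)
map-allFin-suc f =
  cong (f Fin.zero ∷_) (trans (ListP.map-tabulate Fin.suc f) (sym (ListP.map-tabulate id (f ∘ Fin.suc))))

toℚᵘ-frac : ∀ a b → ℚ.toℚᵘ (frac a (suc b)) ≃ᵘ mkℚᵘ (+ a) b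
toℚᵘ-frac a b = ℚP.toℚᵘ-fromℚᵘ (mkℚᵘ (+ a) b)

frac-cross : ∀ a b c d .{{_ : NonZero b}} .{{_ : NonZero d}} →
             a ℕ.* d ≡ c ℕ.* b → frac a b ≡ frac c d
frac-cross a (suc b) c (suc d) eq = ℚP.toℚᵘ-injective
  (ℚᵘP.≃-trans (toℚᵘ-frac a b) (ℚᵘP.≃-trans (*≡* eqℤ) (ℚᵘP.≃-sym (toℚᵘ-frac c d))))
  where
  eqℤ : + a ℤ.* + suc d ≡ + c ℤ.* + suc b
  eqℤ = trans (sym (ℤP.pos-* a (suc d))) (trans (cong +_ eq) (ℤP.pos-* c (suc b)))

frac-* : ∀ a b c d .{{_ : NonZero b}} .{{_ : NonZero d}} →
         frac a b ℚ.* frac c d ≡ frac (a ℕ.* c) (b ℕ.* d)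
frac-* a (suc b) c (suc d) = ℚP.toℚᵘ-injective
  (ℚᵘP.≃-trans (ℚP.toℚᵘ-homo-* (frac a (suc b)) (frac c (suc d)))
  (ℚᵘP.≃-trans (ℚᵘP.*-cong (toℚᵘ-frac a b) (toℚᵘ-frac c d))
  (ℚᵘP.≃-trans (ℚᵘP.≃-reflexive (cong (λ z → mkℚᵘ z _) (sym (ℤP.pos-* a c))))
               (ℚᵘP.≃-sym (toℚᵘ-frac (a ℕ.* c) _)))))

frac-+ : ∀ a b c d .{{_ : NonZero b}} .{{_ : NonZero d}} →
         frac a b ℚ.+ frac c d ≡ frac (a ℕ.* d ℕ.+ c ℕ.* b) (b ℕ.* d)
frac-+ a (suc b) c (suc d) = ℚP.toℚᵘ-injective
  (ℚᵘP.≃-trans (ℚP.toℚᵘ-homo-+ (frac a (suc b)) (frac c (suc d)))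
  (ℚᵘP.≃-trans (ℚᵘP.+-cong (toℚᵘ-frac a b) (toℚᵘ-frac c d))
  (ℚᵘP.≃-trans (ℚᵘP.≃-reflexive (cong (λ z → mkℚᵘ z _) (sym numerator)))
               (ℚᵘP.≃-sym (toℚᵘ-frac (a ℕ.* suc d ℕ.+ c ℕ.* suc b) _)))))
  where
  numerator : + (a ℕ.* suc d ℕ.+ c ℕ.* suc b) ≡ + a ℤ.* + suc d ℤ.+ + c ℤ.* + suc b
  numerator = trans (ℤP.pos-+ (a ℕ.* suc d) (c ℕ.* suc b))
                    (cong₂ ℤ._+_ (ℤP.pos-* a (suc d)) (ℤP.pos-* c (suc b)))

frac-0 : ∀ d → frac 0 d ≡ 0ℚ
frac-0 zero    = refl
frac-0 (suc d) = ℚP.0/n≡0 (suc d)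

frac-self : ∀ d .{{_ : NonZero d}} → frac d d ≡ 1ℚ
frac-self d = frac-cross d d 1 1 (ℕP.*-comm d 1)

frac-if : ∀ b d .{{_ : NonZero d}} → frac (if b then 0 else d) d ≡ (if b then 0ℚ else 1ℚ)
frac-if true  d = frac-0 d
frac-if false d = frac-self d

frac-nonNeg : ∀ a d → 0ℚ ≤ frac a d
frac-nonNeg a zero    = ℚP.≤-refl
frac-nonNeg a (suc d) = ℚP.nonNegative⁻¹ _ {{ℚP.normalize-nonNeg a (suc d)}}

frac-+-common : ∀ a b d → frac a d ℚ.+ frac b d ≡ frac (a ℕ.+ b) d
frac-+-common a b zero    = refl
frac-+-common a b d@(suc _) = trans (frac-+ a d b d) (frac-cross (a ℕ.* d ℕ.+ b ℕ.* d) (d ℕ.* d) (a ℕ.+ b) d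
  (solve 3 (λ a b d → (a :* d :+ b :* d) :* d := (a :+ b) :* (d :* d)) refl a b d))
  where open +-*-Solver

n*[m/n+1]≡m+n : ∀ m n .{{_ : NonZero n}} → frac n 1 ℚ.* (frac m n ℚ.+ 1ℚ) ≡ frac (m ℕ.+ n) 1
n*[m/n+1]≡m+n m n@(suc _) = begin
  frac n 1 ℚ.* (frac m n ℚ.+ frac 1 1)    ≡⟨ cong (frac n 1 ℚ.*_) (frac-+ m n 1 1) ⟩
  frac n 1 ℚ.* frac s (n ℕ.* 1)           ≡⟨ frac-* n 1 s (n ℕ.* 1) ⟩
  frac (n ℕ.* s) (1 ℕ.* (n ℕ.* 1))        ≡⟨ frac-cross (n ℕ.* s) (1 ℕ.* (n ℕ.* 1)) (m ℕ.+ n) 1 cross ⟩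
  frac (m ℕ.+ n) 1                        ∎
  where
  open ≡-Reasoning
  open +-*-Solver
  s = m ℕ.* 1 ℕ.+ 1 ℕ.* n
  cross : n ℕ.* s ℕ.* 1 ≡ (m ℕ.+ n) ℕ.* (1 ℕ.* (n ℕ.* 1))
  cross = solve 2 (λ m n → n :* (m :* con 1 :+ con 1 :* n) :* con 1 := (m :+ n) :* (con 1 :* (n :* con 1)))
                refl m n

ab/z*[h*c/a]≡h*bc/z : ∀ a b c z h .{{_ : NonZero a}} .{{_ : NonZero z}} →
                      frac (a ℕ.* b) z ℚ.* (h ℚ.* frac c a) ≡ h ℚ.* frac (b ℕ.* c) z
ab/z*[h*c/a]≡h*bc/z a b c z h = begin
  x ℚ.* (h ℚ.* y)                      ≡⟨ x*[h*y]≡h*[x*y] ⟩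
  h ℚ.* (x ℚ.* y)                      ≡⟨ cong (h ℚ.*_) (frac-* (a ℕ.* b) z c a) ⟩
  h ℚ.* frac (a ℕ.* b ℕ.* c) (z ℕ.* a) ≡⟨ cong (h ℚ.*_) (frac-cross _ (z ℕ.* a) (b ℕ.* c) z cross) ⟩
  h ℚ.* frac (b ℕ.* c) z               ∎
  where
  open ≡-Reasoning
  x = frac (a ℕ.* b) z
  y = frac c a
  instance _ = ℕP.m*n≢0 z a
  x*[h*y]≡h*[x*y] : x ℚ.* (h ℚ.* y) ≡ h ℚ.* (x ℚ.* y)
  x*[h*y]≡h*[x*y] = solve 3 (λ x h y → x :* (h :* y) := h :* (x :* y)) refl x h y
    where open ℚS.+-*-Solver
  cross : a ℕ.* b ℕ.* c ℕ.* z ≡ b ℕ.* c ℕ.* (z ℕ.* a)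
  cross = solve 4 (λ a b c z → a :* b :* c :* z := b :* c :* (z :* a)) refl a b c z
    where open +-*-Solver

qdiv-*-cancelʳ : ∀ p q → q ≢ 0ℚ → qdiv (p ℚ.* q) q ≡ p
qdiv-*-cancelʳ p q q≢0 with q ℚP.≟ 0ℚ
... | yes q≡0 = ⊥-elim (q≢0 q≡0)
... | no  _   = begin
  (p ℚ.* q) ℚ.* ℚ.1/ q ≡⟨ ℚP.*-assoc p q (ℚ.1/ q) ⟩
  p ℚ.* (q ℚ.* ℚ.1/ q) ≡⟨ cong (p ℚ.*_) (ℚP.*-inverseʳ q) ⟩
  p ℚ.* 1ℚ             ≡⟨ ℚP.*-identityʳ p ⟩
  p                    ∎
  where
  open ≡-Reasoning
  instance _ = ℚ.≢-nonZero q≢0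

qdiv-frac : ∀ a d .{{_ : NonZero d}} → qdiv (frac a 1) (frac d 1) ≡ frac a d
qdiv-frac a d@(suc _) = trans (cong (λ p → qdiv p (frac d 1)) a≡a/d*d)
                              (qdiv-*-cancelʳ (frac a d) (frac d 1) d≢0)
  where
  a≡a/d*d : frac a 1 ≡ frac a d ℚ.* frac d 1
  a≡a/d*d = sym (trans (frac-* a d d 1) (frac-cross (a ℕ.* d) (d ℕ.* 1) a 1
    (solve 2 (λ a d → a :* d :* con 1 := a :* (d :* con 1)) refl a d)))
    where open +-*-Solver
  d≢0 : frac d 1 ≢ 0ℚ
  d≢0 = ≢-sym (ℚP.<⇒≢ (ℚP.positive⁻¹ _ {{ℚP.normalize-pos d 1}}))

sum-frac : ∀ {A : Set} (f : A → ℕ) d xs → qsum (map (λ x → frac (f x) d) xs) ≡ frac (ℕsum (map f xs)) d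
sum-frac f d []       = sym (frac-0 d)
sum-frac f d (x ∷ xs) = trans (cong (frac (f x) d ℚ.+_) (sum-frac f d xs)) (frac-+-common (f x) _ d)

if-exclusive : ∀ a b c {x y z : ℚ} →
               (a ≡ true → b ≡ false) → (a ≡ true → c ≡ false) → (b ≡ true → c ≡ false) →
               (if a then x else if b then y else if c then z else 0ℚ)
                 ≡ (if a then x else 0ℚ) ℚ.+ ((if b then y else 0ℚ) ℚ.+ (if c then z else 0ℚ))
if-exclusive true  _    _ {x} a⇒¬b a⇒¬c _ rewrite a⇒¬b refl | a⇒¬c refl = sym (ℚP.+-identityʳ x)
if-exclusive false true _ {y = y} _ _ b⇒¬c rewrite b⇒¬c refl =
  sym (trans (ℚP.+-identityˡ _) (ℚP.+-identityʳ y))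
if-exclusive false false c _ _ _ = sym (trans (ℚP.+-identityˡ _) (ℚP.+-identityˡ _))

sum-δ : ∀ {k} (i : Fin k) c → qsum (map (λ j → if does (i Fin.≟ j) then c else 0ℚ) (List.allFin k)) ≡ c
sum-δ {suc k} Fin.zero c =
  trans (cong qsum (map-allFin-suc {k = k} (λ j → if does (Fin.zero Fin.≟ j) then c else 0ℚ)))
        (trans (cong (c ℚ.+_) (ℚΣ.sum-map-0 (List.allFin k))) (ℚP.+-identityʳ c))
sum-δ {suc k} (Fin.suc i) c =
  trans (cong qsum (map-allFin-suc {k = k} (λ j → if does (Fin.suc i Fin.≟ j) then c else 0ℚ)))
        (trans (ℚP.+-identityˡ _) (sum-δ i c))

data Chain {A : Set} (_≺_ : A → A → Set) : ℕ → A → Set where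
  []  : ∀ {u} → Chain _≺_ zero u
  _∷_ : ∀ {k u v} → u ≺ v → Chain _≺_ k v → Chain _≺_ (suc k) u

module _ {A : Set} {_≺_ : A → A → Set} where

  fuel-agree : ∀ {B : Set} (f g : ℕ → A → B) →
               (∀ k u → (∀ {v} → u ≺ v → f k v ≡ g k v) → f (suc k) u ≡ g (suc k) u) →
               ∀ k u → ¬ Chain _≺_ k u → f k u ≡ g k u
  fuel-agree f g step zero    u no-chain = ⊥-elim (no-chain [])
  fuel-agree f g step (suc k) u no-chain =
    step k u (λ u≺v → fuel-agree f g step k _ (λ c → no-chain (u≺v ∷ c)))

  node : ∀ {k u} → Chain _≺_ k u → Fin (suc k) → A
  node {u = u} c       Fin.zero    = u
  node         (_ ∷ c) (Fin.suc i) = node c i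

  module _ (w : A → ℤ) (w-mono : ∀ {u v} → u ≺ v → w u ℤ.< w v) where

    w-head≤w-node : ∀ {k u} (c : Chain _≺_ k u) i → w u ℤ.≤ w (node c i)
    w-head≤w-node c         Fin.zero    = ℤP.≤-refl
    w-head≤w-node (u≺v ∷ c) (Fin.suc i) = ℤP.≤-trans (ℤP.<⇒≤ (w-mono u≺v)) (w-head≤w-node c i)

    w-node-mono : ∀ {k u} (c : Chain _≺_ k u) {i j} → i Fin.< j → w (node c i) ℤ.< w (node c j)
    w-node-mono (u≺v ∷ c) {Fin.zero}  {Fin.suc j} _       = ℤP.<-≤-trans (w-mono u≺v) (w-head≤w-node c j)
    w-node-mono (_ ∷ c)   {Fin.suc i} {Fin.suc j} (s≤s p) = w-node-mono c p

graded⇒¬Chain : ∀ {n} {_≺_ : Fin n → Fin n → Set} (w : Fin n → ℤ) →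
                (∀ {u v} → u ≺ v → w u ℤ.< w v) → ∀ u → ¬ Chain _≺_ n u
graded⇒¬Chain {n} w w-mono u c with FinP.pigeonhole (ℕP.n<1+n n) (node c)
... | i , j , i<j , same = ℤP.<-irrefl (cong w same) (w-node-mono w w-mono c i<j)

module Walk {n : ℕ} (Γ : DoubleCover n) where
  open DoubleCover Γ
  open Quotient Γ

  ∈qnodes⇒canon : ∀ {v} → v ∈ qnodes → canon v ≡ true
  ∈qnodes⇒canon = proj₂ ∘ ∈-filter⁻ (λ u → canon u Bool.≟ true) {xs = List.allFin n}

  canon⇒∈qnodes : ∀ {v} → canon v ≡ true → v ∈ qnodes
  canon⇒∈qnodes {v} = ∈-filter⁺ (λ u → canon u Bool.≟ true) (∈-allFin v)

  ∈ups⇒sub : ∀ {u v} → v ∈ ups u → sub u v ≡ true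
  ∈ups⇒sub {u} = proj₂ ∘ ∈-filter⁻ (λ v → sub u v Bool.≟ true) {xs = qnodes}

  ∈downs⇒sub : ∀ {u t} → t ∈ downs u → sub t u ≡ true
  ∈downs⇒sub {u} = proj₂ ∘ ∈-filter⁻ (λ t → sub t u Bool.≟ true) {xs = qnodes}

  Up Down : Fin n → Fin n → Set
  Up   u v = v ∈ ups u
  Down u t = t ∈ downs u

  ¬Chain-Up : ∀ u → ¬ Chain Up n u
  ¬Chain-Up = graded⇒¬Chain dim (λ v∈ups → dim-mono _ _ (∈ups⇒sub v∈ups))

  ¬Chain-Down : ∀ u → ¬ Chain Down n u
  ¬Chain-Down = graded⇒¬Chain (ℤ.-_ ∘ dim) (λ t∈downs → ℤP.neg-mono-< (dim-mono _ _ (∈downs⇒sub t∈downs)))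

  -- LP, RP and paths are computed with fuel n; dim is strictly monotone along ups and downs, so
  -- no chain has n steps and fuel n is already a fixpoint of the defining recursion.
  LP-unfold : ∀ u → LP u ≡ (if isLeaf u then 1 else ℕsum (map LP (ups u)))
  LP-unfold u = fuel-agree LPf (LPf ∘ suc) step n u (¬Chain-Up u)
    where
    step : ∀ k u → (∀ {v} → Up u v → LPf k v ≡ LPf (suc k) v) → LPf (suc k) u ≡ LPf (suc (suc k)) u
    step k u agree = cong (λ xs → if isLeaf u then 1 else ℕsum xs) (ListP.map-cong-local (All.tabulate agree))

  RP-unfold : ∀ u → RP u ≡ (if isRoot u then 1 else ℕsum (map RP (downs u)))
  RP-unfold u = fuel-agree RPf (RPf ∘ suc) step n u (¬Chain-Down u)
    where
    step : ∀ k u → (∀ {t} → Down u t → RPf k t ≡ RPf (suc k) t) → RPf (suc k) u ≡ RPf (suc (suc k)) u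
    step k u agree = cong (λ xs → if isRoot u then 1 else ℕsum xs) (ListP.map-cong-local (All.tabulate agree))

  LPf-pos : ∀ k u → 0 ℕ.< LPf k u
  LPf-pos zero    u = ℕ.z<s
  LPf-pos (suc k) u with isLeaf u in leaf
  ... | true  = ℕ.z<s
  ... | false = sum-pos (LPf k) (ups u) leaf (LPf-pos k)

  RPf-pos : ∀ k u → 0 ℕ.< RPf k u
  RPf-pos zero    u = ℕ.z<s
  RPf-pos (suc k) u with isRoot u in root
  ... | true  = ℕ.z<s
  ... | false = sum-pos (RPf k) (downs u) root (RPf-pos k)

  instance
    LP-nonZero : ∀ {u} → NonZero (LP u)
    LP-nonZero {u} = ℕ.>-nonZero (LPf-pos n u)

    RP-nonZero : ∀ {u} → NonZero (RP u)
    RP-nonZero {u} = ℕ.>-nonZero (RPf-pos n u)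

  sum-LP-ups : ∀ u → ℕsum (map LP (ups u)) ≡ (if isLeaf u then 0 else LP u)
  sum-LP-ups u rewrite LP-unfold u with isLeaf u in leaf
  ... | true  = cong (ℕsum ∘ map LP) (null⇒≡[] leaf)
  ... | false = refl

  sum-RP-downs : ∀ u → ℕsum (map RP (downs u)) ≡ (if isRoot u then 0 else RP u)
  sum-RP-downs u rewrite RP-unfold u with isRoot u in root
  ... | true  = cong (ℕsum ∘ map RP) (null⇒≡[] root)
  ... | false = refl

  paths : Fin n → List (List (Fin n))
  paths = pathsF n

  paths-unfold : ∀ u → paths u ≡ (if isLeaf u then (u ∷ []) ∷ []
                                   else concatMap (λ v → map (u ∷_) (paths v)) (ups u))
  paths-unfold u = fuel-agree pathsF (pathsF ∘ suc) step n u (¬Chain-Up u)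
    where
    step : ∀ k u → (∀ {v} → Up u v → pathsF k v ≡ pathsF (suc k) v) →
           pathsF (suc k) u ≡ pathsF (suc (suc k)) u
    step k u agree = cong (λ pss → if isLeaf u then (u ∷ []) ∷ [] else List.concat pss)
                          (ListP.map-cong-local (All.tabulate (cong (map (u ∷_)) ∘ agree)))

  length-paths : ∀ u → length (paths u) ≡ LP u
  length-paths u = fuel-agree (λ k → length ∘ pathsF k) LPf step n u (¬Chain-Up u)
    where
    step : ∀ k u → (∀ {v} → Up u v → length (pathsF k v) ≡ LPf k v) →
           length (pathsF (suc k) u) ≡ LPf (suc k) u
    step k u agree with isLeaf u
    ... | true  = refl
    ... | false = trans (length-concatMap (λ v → map (u ∷_) (pathsF k v)) (ups u))
                        (cong ℕsum (ListP.map-cong-local (All.tabulate λ {v} v∈ups →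
                          trans (ListP.length-map (u ∷_) (pathsF k v)) (agree v∈ups))))

  ∈paths⇒suc-len : ∀ {u η} → η ∈ paths u → suc (len η) ≡ length η
  ∈paths⇒suc-len {u} {η} η∈ rewrite paths-unfold u with isLeaf u
  ... | true  with η∈
  ...   | here refl = refl
  ∈paths⇒suc-len {u} {η} η∈ | false with satisfied (∈-concatMap⁻ (λ v → map (u ∷_) (paths v)) {xs = ups u} η∈)
  ... | _ , η∈map with ∈-map⁻ (u ∷_) η∈map
  ...   | _ , _ , refl = refl

  pathNodes : Fin n → ℕ
  pathNodes u = ℕsum (map length (paths u))

  pathNodes-unfold : ∀ u → ℕsum (map length (paths u)) ≡ LP u ℕ.+ ℕsum (map pathNodes (ups u))
  pathNodes-unfold u rewrite paths-unfold u | LP-unfold u with isLeaf u in leaf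
  ... | true rewrite null⇒≡[] leaf = refl
  ... | false = begin
    ℕsum (map length (concatMap (λ v → map (u ∷_) (paths v)) (ups u)))
      ≡⟨ ℕΣ.sum-concatMap length (λ v → map (u ∷_) (paths v)) (ups u) ⟩
    ℕsum (map (λ v → ℕsum (map length (map (u ∷_) (paths v)))) (ups u))
      ≡⟨ cong ℕsum (ListP.map-cong (λ v → trans (cong ℕsum (sym (ListP.map-∘ (paths v))))
                                                 (sum-map-suc length (paths v))) (ups u)) ⟩
    ℕsum (map (λ v → pathNodes v ℕ.+ length (paths v)) (ups u))
      ≡⟨ ℕΣ.sum-map-+ pathNodes (length ∘ paths) (ups u) ⟩
    ℕsum (map pathNodes (ups u)) ℕ.+ ℕsum (map (length ∘ paths) (ups u))
      ≡⟨ ℕP.+-comm (ℕsum (map pathNodes (ups u))) _ ⟩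
    ℕsum (map (length ∘ paths) (ups u)) ℕ.+ ℕsum (map pathNodes (ups u))
      ≡⟨ cong (ℕ._+ ℕsum (map pathNodes (ups u))) (cong ℕsum (ListP.map-cong length-paths (ups u))) ⟩
    ℕsum (map LP (ups u)) ℕ.+ ℕsum (map pathNodes (ups u)) ∎
    where open ≡-Reasoning

  sub-asym : ∀ {u v} → sub u v ≡ true → sub v u ≡ false
  sub-asym {u} {v} s = ¬-not (λ s' → ℤP.<-asym (dim-mono u v s) (dim-mono v u s'))

  sameQ-dim : ∀ u v → sameQ u v ≡ true → dim u ≡ dim v
  sameQ-dim u v same with u Fin.≟ v | v Fin.≟ neg u
  ... | yes refl | _        = refl
  ... | no _     | yes refl = sym (dim-neg u)

  sub⇒¬sameQ : ∀ {u v} → sub u v ≡ true → sameQ u v ≡ false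
  sub⇒¬sameQ {u} {v} s = ¬-not (λ same → ℤP.<-irrefl (sameQ-dim u v same) (dim-mono u v s))

  sub˘⇒¬sameQ : ∀ {u v} → sub v u ≡ true → sameQ u v ≡ false
  sub˘⇒¬sameQ {u} {v} s = ¬-not (λ same → ℤP.<-irrefl (sym (sameQ-dim u v same)) (dim-mono v u s))

  canon-neg : ∀ {u} → canon u ≡ true → canon (neg u) ≡ false
  canon-neg {u} cu = ¬-not λ cnu → ℕP.<-asym (<ᵇ-true {toℕ u} cu) (<ᵇ-true {toℕ (neg u)} (canon-neg≡ cnu))
    where
    canon-neg≡ : canon (neg u) ≡ true → (toℕ (neg u) ℕ.<ᵇ toℕ u) ≡ true
    canon-neg≡ = trans (cong (λ w → toℕ (neg u) ℕ.<ᵇ toℕ w) (sym (neg-invol u)))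
    <ᵇ-true : ∀ {a b} → (a ℕ.<ᵇ b) ≡ true → a ℕ.< b
    <ᵇ-true {a} {b} eq = ℕP.<ᵇ⇒< a b (Equivalence.from BoolP.T-≡ eq)

  canon-sameQ : ∀ {u u'} → canon u ≡ true → canon u' ≡ true → sameQ u u' ≡ does (u Fin.≟ u')
  canon-sameQ {u} {u'} cu cu' =
    trans (cong (does (u Fin.≟ u') ∨_) (dec-false (u' Fin.≟ neg u) u'≢-u)) (BoolP.∨-identityʳ _)
    where
    u'≢-u : u' ≢ neg u
    u'≢-u refl = BoolP.not-¬ (canon-neg cu) cu'

  loop : Fin n → ℚ
  loop u = if isLeaf u ∧ isRoot u then 1ℚ else if isLeaf u ∨ isRoot u then half else 0ℚ

  moveUp moveDown stay : Fin n → Fin n → ℚ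
  moveUp   u u' = if sub u u' then half ℚ.* frac (LP u') (LP u) else 0ℚ
  moveDown u u' = if sub u' u then half ℚ.* frac (RP u') (RP u) else 0ℚ
  stay     u u' = if sameQ u u' then loop u else 0ℚ

  P-split : ∀ u u' → P u u' ≡ moveUp u u' ℚ.+ (moveDown u u' ℚ.+ stay u u')
  P-split u u' = if-exclusive (sub u u') (sub u' u) (sameQ u u') sub-asym sub⇒¬sameQ sub˘⇒¬sameQ

  P-up : ∀ {u u'} → sub u u' ≡ true → P u u' ≡ half ℚ.* frac (LP u') (LP u)
  P-up s = BoolP.if-cong s

  P-down : ∀ {u u'} → sub u u' ≡ true → P u' u ≡ half ℚ.* frac (RP u) (RP u')
  P-down s = trans (BoolP.if-cong (sub-asym s)) (BoolP.if-cong s)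

  P-distinct : ∀ {u u'} → canon u ≡ true → canon u' ≡ true → u ≢ u' →
               sub u u' ≡ false → sub u' u ≡ false → P u u' ≡ 0ℚ
  P-distinct {u} {u'} cu cu' u≢u' s s' =
    trans (BoolP.if-cong s) (trans (BoolP.if-cong s') (BoolP.if-cong sameQ≡false))
    where
    sameQ≡false : sameQ u u' ≡ false
    sameQ≡false = trans (canon-sameQ cu cu') (dec-false (u Fin.≟ u') u≢u')

  sum-half-frac-filter : ∀ (p : Fin n → Bool) (w : Fin n → ℕ) d →
    qsum (map (λ v → if p v then half ℚ.* frac (w v) d else 0ℚ) qnodes)
      ≡ half ℚ.* frac (ℕsum (map w (filter (λ v → p v Bool.≟ true) qnodes))) d
  sum-half-frac-filter p w d = begin
    qsum (map (λ v → if p v then half ℚ.* frac (w v) d else 0ℚ) qnodes)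
      ≡⟨ sym (ℚΣ.sum-filter p (λ v → half ℚ.* frac (w v) d) qnodes) ⟩
    qsum (map (λ v → half ℚ.* frac (w v) d) ps)
      ≡⟨ ℚΣ.sum-map-*ˡ half (λ v → frac (w v) d) ps ⟩
    half ℚ.* qsum (map (λ v → frac (w v) d) ps)
      ≡⟨ cong (half ℚ.*_) (sum-frac w d ps) ⟩
    half ℚ.* frac (ℕsum (map w ps)) d ∎
    where
    open ≡-Reasoning
    ps = filter (λ v → p v Bool.≟ true) qnodes

  sum-moveUp : ∀ u → qsum (map (moveUp u) qnodes) ≡ half ℚ.* (if isLeaf u then 0ℚ else 1ℚ)
  sum-moveUp u = trans (sum-half-frac-filter (sub u) LP (LP u))
    (cong (half ℚ.*_) (trans (cong (λ m → frac m (LP u)) (sum-LP-ups u)) (frac-if (isLeaf u) (LP u))))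

  sum-moveDown : ∀ u → qsum (map (moveDown u) qnodes) ≡ half ℚ.* (if isRoot u then 0ℚ else 1ℚ)
  sum-moveDown u = trans (sum-half-frac-filter (λ t → sub t u) RP (RP u))
    (cong (half ℚ.*_) (trans (cong (λ m → frac m (RP u)) (sum-RP-downs u)) (frac-if (isRoot u) (RP u))))

  sum-sameQ : ∀ {u} c → canon u ≡ true → qsum (map (λ u' → if sameQ u u' then c else 0ℚ) qnodes) ≡ c
  sum-sameQ {u} c cu = begin
    qsum (map (λ u' → if sameQ u u' then c else 0ℚ) qnodes)
      ≡⟨ ℚΣ.sum-filter canon (λ u' → if sameQ u u' then c else 0ℚ) (List.allFin n) ⟩
    qsum (map (λ u' → if canon u' then (if sameQ u u' then c else 0ℚ) else 0ℚ) (List.allFin n))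
      ≡⟨ cong qsum (ListP.map-cong on-canon (List.allFin n)) ⟩
    qsum (map (λ u' → if does (u Fin.≟ u') then c else 0ℚ) (List.allFin n))
      ≡⟨ sum-δ u c ⟩
    c ∎
    where
    open ≡-Reasoning
    on-canon : ∀ u' → (if canon u' then (if sameQ u u' then c else 0ℚ) else 0ℚ)
                        ≡ (if does (u Fin.≟ u') then c else 0ℚ)
    on-canon u' with canon u' in cu'
    ... | true  = cong (λ b → if b then c else 0ℚ) (canon-sameQ cu cu')
    ... | false = cong (λ b → if b then c else 0ℚ)
                       (sym (dec-false (u Fin.≟ u') λ { refl → BoolP.not-¬ cu cu' }))

  move+stay≡1 : ∀ a b → half ℚ.* (if a then 0ℚ else 1ℚ)
                        ℚ.+ (half ℚ.* (if b then 0ℚ else 1ℚ)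
                        ℚ.+ (if a ∧ b then 1ℚ else if a ∨ b then half else 0ℚ)) ≡ 1ℚ
  move+stay≡1 true  true  = refl
  move+stay≡1 true  false = refl
  move+stay≡1 false true  = refl
  move+stay≡1 false false = refl

  row-sum : ∀ u → canon u ≡ true → qsum (map (P u) qnodes) ≡ 1ℚ
  row-sum u cu = begin
    qsum (map (P u) qnodes)
      ≡⟨ cong qsum (ListP.map-cong (P-split u) qnodes) ⟩
    qsum (map (λ u' → moveUp u u' ℚ.+ (moveDown u u' ℚ.+ stay u u')) qnodes)
      ≡⟨ ℚΣ.sum-map-+ (moveUp u) (λ u' → moveDown u u' ℚ.+ stay u u') qnodes ⟩
    qsum (map (moveUp u) qnodes) ℚ.+ qsum (map (λ u' → moveDown u u' ℚ.+ stay u u') qnodes)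
      ≡⟨ cong (qsum (map (moveUp u) qnodes) ℚ.+_) (ℚΣ.sum-map-+ (moveDown u) (stay u) qnodes) ⟩
    qsum (map (moveUp u) qnodes) ℚ.+ (qsum (map (moveDown u) qnodes) ℚ.+ qsum (map (stay u) qnodes))
      ≡⟨ cong₂ ℚ._+_ (sum-moveUp u) (cong₂ ℚ._+_ (sum-moveDown u) (sum-sameQ (loop u) cu)) ⟩
    half ℚ.* (if isLeaf u then 0ℚ else 1ℚ) ℚ.+ (half ℚ.* (if isRoot u then 0ℚ else 1ℚ) ℚ.+ loop u)
      ≡⟨ move+stay≡1 (isLeaf u) (isRoot u) ⟩
    1ℚ ∎
    where open ≡-Reasoning

  module Component (C : Fin n → Bool)
    (C⇒canon : ∀ x → C x ≡ true → canon x ≡ true) (c₀ : Fin n) (C-c₀ : C c₀ ≡ true)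
    (closed : ∀ x y → C x ≡ true → canon y ≡ true → adj x y ≡ true → C y ≡ true) where

    C-edge : ∀ {u v} → canon u ≡ true → canon v ≡ true → sub u v ≡ true → C u ≡ C v
    C-edge {u} {v} cu cv s with C u in Cu | C v in Cv
    ... | true  | true  = refl
    ... | false | false = refl
    ... | true  | false = trans (sym (closed u v Cu cv adj-uv)) Cv
      where
      adj-uv : adj u v ≡ true
      adj-uv = cong (_∨ sub v u) s
    ... | false | true  = trans (sym Cu) (closed v u Cv cu adj-vu)
      where
      adj-vu : adj v u ≡ true
      adj-vu = trans (cong (sub v u ∨_) s) (BoolP.∨-zeroʳ (sub v u))

    C-edge-if : ∀ {u v} x → canon u ≡ true → canon v ≡ true →
                (if C u then (if sub u v then x else 0) else 0)
                  ≡ (if C v then (if sub u v then x else 0) else 0)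
    C-edge-if {u} {v} x cu cv with sub u v in s
    ... | true  = cong (λ b → if b then x else 0) (C-edge cu cv s)
    ... | false with C u | C v
    ...   | true  | true  = refl
    ...   | true  | false = refl
    ...   | false | true  = refl
    ...   | false | false = refl

    members roots : List (Fin n)
    members = filter (λ u → C u Bool.≟ true) qnodes
    roots   = filter (λ r → (C r ∧ isRoot r) Bool.≟ true) qnodes

    sum-ups≡sum-downs : ∀ (F : Fin n → Fin n → ℕ) →
      ℕsum (map (λ u → ℕsum (map (F u) (ups u))) members)
        ≡ ℕsum (map (λ v → ℕsum (map (λ u → F u v) (downs v))) members)
    sum-ups≡sum-downs F = begin
      ℕsum (map (λ u → ℕsum (map (F u) (ups u))) members)
        ≡⟨ ℕΣ.sum-filter C _ qnodes ⟩
      ℕsum (map (λ u → if C u then ℕsum (map (F u) (ups u)) else 0) qnodes)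
        ≡⟨ cong ℕsum (ListP.map-cong (λ u → ℕΣ.sum-if-filter (C u) (sub u) (F u) qnodes) qnodes) ⟩
      ℕsum (map (λ u → ℕsum (map (λ v → G (C u) u v) qnodes)) qnodes)
        ≡⟨ cong ℕsum (ListP.map-cong-local (All.tabulate λ u∈ →
             cong ℕsum (ListP.map-cong-local (All.tabulate λ v∈ →
               C-edge-if (F _ _) (∈qnodes⇒canon u∈) (∈qnodes⇒canon v∈))))) ⟩
      ℕsum (map (λ u → ℕsum (map (λ v → G (C v) u v) qnodes)) qnodes)
        ≡⟨ ℕΣ.sum-swap (λ u v → G (C v) u v) qnodes qnodes ⟩
      ℕsum (map (λ v → ℕsum (map (λ u → G (C v) u v) qnodes)) qnodes)
        ≡⟨ cong ℕsum (ListP.map-cong (λ v →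
             sym (ℕΣ.sum-if-filter (C v) (λ u → sub u v) (λ u → F u v) qnodes)) qnodes) ⟩
      ℕsum (map (λ v → if C v then ℕsum (map (λ u → F u v) (downs v)) else 0) qnodes)
        ≡⟨ sym (ℕΣ.sum-filter C _ qnodes) ⟩
      ℕsum (map (λ v → ℕsum (map (λ u → F u v) (downs v))) members) ∎
      where
      open ≡-Reasoning
      G : Bool → Fin n → Fin n → ℕ
      G b u v = if b then (if sub u v then F u v else 0) else 0

    Z : ℕ
    Z = ℕsum (map (λ u → LP u ℕ.* RP u) members)

    RP*pathNodes-up : ∀ u → RP u ℕ.* pathNodes u
                            ≡ LP u ℕ.* RP u ℕ.+ ℕsum (map (λ v → RP u ℕ.* pathNodes v) (ups u))
    RP*pathNodes-up u = begin
      RP u ℕ.* pathNodes u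
        ≡⟨ cong (RP u ℕ.*_) (pathNodes-unfold u) ⟩
      RP u ℕ.* (LP u ℕ.+ ℕsum (map pathNodes (ups u)))
        ≡⟨ ℕP.*-distribˡ-+ (RP u) (LP u) _ ⟩
      RP u ℕ.* LP u ℕ.+ RP u ℕ.* ℕsum (map pathNodes (ups u))
        ≡⟨ cong₂ ℕ._+_ (ℕP.*-comm (RP u) (LP u)) (sym (ℕΣ.sum-map-*ˡ (RP u) pathNodes (ups u))) ⟩
      LP u ℕ.* RP u ℕ.+ ℕsum (map (λ v → RP u ℕ.* pathNodes v) (ups u)) ∎
      where open ≡-Reasoning

    RP*pathNodes-down : ∀ v → RP v ℕ.* pathNodes v
                              ≡ (if isRoot v then pathNodes v else 0)
                                ℕ.+ ℕsum (map (λ u → RP u ℕ.* pathNodes v) (downs v))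
    RP*pathNodes-down v
      rewrite ℕΣ.sum-map-*ʳ (pathNodes v) RP (downs v) | sum-RP-downs v
      with isRoot v | RP-unfold v
    ... | true  | RP≡1 rewrite RP≡1 = refl
    ... | false | _    = refl

    -- Σ RP·pathNodes over the component, expanded upwards via pathNodes-unfold and downwards via
    -- the recursion of RP, has the same cross term on both sides (exchange of a double sum).
    Z≡sum-pathNodes-roots : Z ≡ ℕsum (map pathNodes roots)
    Z≡sum-pathNodes-roots = ℕP.+-cancelʳ-≡ E Z (ℕsum (map pathNodes roots)) (begin
      Z ℕ.+ E                         ≡⟨ sym expand-up ⟩
      W                               ≡⟨ expand-down ⟩
      R ℕ.+ E′                        ≡⟨ cong₂ ℕ._+_ R≡sum-roots (sym (sum-ups≡sum-downs F)) ⟩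
      ℕsum (map pathNodes roots) ℕ.+ E ∎)
      where
      open ≡-Reasoning
      F : Fin n → Fin n → ℕ
      F u v = RP u ℕ.* pathNodes v
      W  = ℕsum (map (λ u → RP u ℕ.* pathNodes u) members)
      E  = ℕsum (map (λ u → ℕsum (map (F u) (ups u))) members)
      E′ = ℕsum (map (λ v → ℕsum (map (λ u → F u v) (downs v))) members)
      R  = ℕsum (map (λ v → if isRoot v then pathNodes v else 0) members)
      expand-up : W ≡ Z ℕ.+ E
      expand-up = trans (cong ℕsum (ListP.map-cong RP*pathNodes-up members))
                        (ℕΣ.sum-map-+ (λ u → LP u ℕ.* RP u) _ members)
      expand-down : W ≡ R ℕ.+ E′
      expand-down = trans (cong ℕsum (ListP.map-cong RP*pathNodes-down members))
                          (ℕΣ.sum-map-+ (λ v → if isRoot v then pathNodes v else 0) _ members)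
      R≡sum-roots : R ≡ ℕsum (map pathNodes roots)
      R≡sum-roots = trans (ℕΣ.sum-filter C _ qnodes)
        (trans (cong ℕsum (ListP.map-cong (λ v → sym (BoolP.if-∧ (C v))) qnodes))
               (sym (ℕΣ.sum-filter (λ r → C r ∧ isRoot r) pathNodes qnodes)))

    sum-len+count≡Z : ℕsum (map len (rootLeafPaths C)) ℕ.+ length (rootLeafPaths C) ≡ Z
    sum-len+count≡Z = begin
      ℕsum (map len (rootLeafPaths C)) ℕ.+ length (rootLeafPaths C)
        ≡⟨ sym (sum-map-suc len (rootLeafPaths C)) ⟩
      ℕsum (map (suc ∘ len) (rootLeafPaths C))
        ≡⟨ cong ℕsum (ListP.map-cong-local (All.tabulate λ η∈ →
             ∈paths⇒suc-len (proj₂ (satisfied (∈-concatMap⁻ paths {xs = roots} η∈))))) ⟩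
      ℕsum (map length (concatMap paths roots))
        ≡⟨ ℕΣ.sum-concatMap length paths roots ⟩
      ℕsum (map pathNodes roots)
        ≡⟨ sym Z≡sum-pathNodes-roots ⟩
      Z ∎
      where open ≡-Reasoning

    instance
      Z-nonZero : NonZero Z
      Z-nonZero = ℕ.>-nonZero (ℕP.<-≤-trans LP*RP>0 (∈⇒≤sum (λ u → LP u ℕ.* RP u) c₀∈members))
        where
        LP*RP>0 : 0 ℕ.< LP c₀ ℕ.* RP c₀
        LP*RP>0 = ℕ.>-nonZero⁻¹ (LP c₀ ℕ.* RP c₀) {{ℕP.m*n≢0 (LP c₀) (RP c₀)}}
        c₀∈members : c₀ ∈ members
        c₀∈members = ∈-filter⁺ (λ u → C u Bool.≟ true) (canon⇒∈qnodes (C⇒canon c₀ C-c₀)) C-c₀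

    rootLeafPaths-nonZero : NonZero (length (rootLeafPaths C))
    rootLeafPaths-nonZero with rootLeafPaths C | sum-len+count≡Z
    ... | []    | 0≡Z = contradiction (sym 0≡Z) (ℕ.≢-nonZero⁻¹ Z)
    ... | _ ∷ _ | _   = _

    K≡Z : K C ≡ frac Z 1
    K≡Z = trans (n*[m/n+1]≡m+n (ℕsum (map len (rootLeafPaths C))) (length (rootLeafPaths C))
                              {{rootLeafPaths-nonZero}})
                (cong (λ m → frac m 1) sum-len+count≡Z)

    π≡ : ∀ u → π C u ≡ (if C u then frac (LP u ℕ.* RP u) Z else 0ℚ)
    π≡ u = cong (λ q → if C u then q else 0ℚ)
                (trans (cong (qdiv (frac (LP u ℕ.* RP u) 1)) K≡Z) (qdiv-frac (LP u ℕ.* RP u) Z))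

    π-nonNeg : ∀ u → 0ℚ ℚ.≤ π C u
    π-nonNeg u = subst (0ℚ ℚ.≤_) (sym (π≡ u)) (on-C (C u))
      where
      on-C : ∀ b → 0ℚ ℚ.≤ (if b then frac (LP u ℕ.* RP u) Z else 0ℚ)
      on-C true  = frac-nonNeg (LP u ℕ.* RP u) Z
      on-C false = ℚP.≤-refl

    π-sum : qsum (map (π C) qnodes) ≡ 1ℚ
    π-sum = begin
      qsum (map (π C) qnodes)                          ≡⟨ cong qsum (ListP.map-cong π≡frac qnodes) ⟩
      qsum (map (λ u → frac (mass u) Z) qnodes)        ≡⟨ sum-frac mass Z qnodes ⟩
      frac (ℕsum (map mass qnodes)) Z                  ≡⟨ cong (λ m → frac m Z) (sym (ℕΣ.sum-filter C _ qnodes)) ⟩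
      frac Z Z                                         ≡⟨ frac-self Z ⟩
      1ℚ                                               ∎
      where
      open ≡-Reasoning
      mass : Fin n → ℕ
      mass u = if C u then LP u ℕ.* RP u else 0
      π≡frac : ∀ u → π C u ≡ frac (mass u) Z
      π≡frac u = trans (π≡ u) (sym (trans (BoolP.if-float (λ m → frac m Z) (C u))
                                          (BoolP.if-cong-else (C u) (frac-0 Z))))

    balance : ∀ b {u u'} →
              (if b then frac (LP u ℕ.* RP u) Z else 0ℚ) ℚ.* (half ℚ.* frac (LP u') (LP u))
                ≡ (if b then frac (LP u' ℕ.* RP u') Z else 0ℚ) ℚ.* (half ℚ.* frac (RP u) (RP u'))
    balance false {u} {u'} =
      trans (ℚP.*-zeroˡ (half ℚ.* frac (LP u') (LP u))) (sym (ℚP.*-zeroˡ (half ℚ.* frac (RP u) (RP u'))))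
    balance true {u} {u'} = begin
      frac (LP u ℕ.* RP u) Z ℚ.* (half ℚ.* frac (LP u') (LP u))
        ≡⟨ ab/z*[h*c/a]≡h*bc/z (LP u) (RP u) (LP u') Z half ⟩
      half ℚ.* frac (RP u ℕ.* LP u') Z
        ≡⟨ cong (λ m → half ℚ.* frac m Z) (ℕP.*-comm (RP u) (LP u')) ⟩
      half ℚ.* frac (LP u' ℕ.* RP u) Z
        ≡⟨ sym (ab/z*[h*c/a]≡h*bc/z (RP u') (LP u') (RP u) Z half) ⟩
      frac (RP u' ℕ.* LP u') Z ℚ.* (half ℚ.* frac (RP u) (RP u'))
        ≡⟨ cong (λ m → frac m Z ℚ.* (half ℚ.* frac (RP u) (RP u'))) (ℕP.*-comm (RP u') (LP u')) ⟩
      frac (LP u' ℕ.* RP u') Z ℚ.* (half ℚ.* frac (RP u) (RP u')) ∎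
      where open ≡-Reasoning

    detailed-balance-edge : ∀ u u' → canon u ≡ true → canon u' ≡ true → sub u u' ≡ true →
                            π C u ℚ.* P u u' ≡ π C u' ℚ.* P u' u
    detailed-balance-edge u u' cu cu' s = begin
      π C u ℚ.* P u u'
        ≡⟨ cong₂ ℚ._*_ (π≡ u) (P-up {u} {u'} s) ⟩
      πᵤ (C u) ℚ.* (half ℚ.* frac (LP u') (LP u))
        ≡⟨ cong (λ b → πᵤ b ℚ.* (half ℚ.* frac (LP u') (LP u))) (C-edge cu cu' s) ⟩
      πᵤ (C u') ℚ.* (half ℚ.* frac (LP u') (LP u))
        ≡⟨ balance (C u') ⟩
      (if C u' then frac (LP u' ℕ.* RP u') Z else 0ℚ) ℚ.* (half ℚ.* frac (RP u) (RP u'))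
        ≡⟨ sym (cong₂ ℚ._*_ (π≡ u') (P-down {u} {u'} s)) ⟩
      π C u' ℚ.* P u' u ∎
      where
      open ≡-Reasoning
      πᵤ : Bool → ℚ
      πᵤ b = if b then frac (LP u ℕ.* RP u) Z else 0ℚ

    detailed-balance : ∀ u u' → canon u ≡ true → canon u' ≡ true →
                       π C u ℚ.* P u u' ≡ π C u' ℚ.* P u' u
    detailed-balance u u' cu cu' = cases (u Fin.≟ u') (sub u u') refl (sub u' u) refl
      where
      cases : Dec (u ≡ u') → ∀ a → sub u u' ≡ a → ∀ b → sub u' u ≡ b →
              π C u ℚ.* P u u' ≡ π C u' ℚ.* P u' u
      cases _          true  s _    _  = detailed-balance-edge u u' cu cu' s
      cases _          false _ true s' = sym (detailed-balance-edge u' u cu' cu s')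
      cases (yes refl) false _ false _ = refl
      cases (no u≢u')  false s false s' = begin
        π C u ℚ.* P u u'   ≡⟨ cong (π C u ℚ.*_) (P-distinct cu cu' u≢u' s s') ⟩
        π C u ℚ.* 0ℚ       ≡⟨ ℚP.*-zeroʳ (π C u) ⟩
        0ℚ                 ≡⟨ sym (ℚP.*-zeroʳ (π C u')) ⟩
        π C u' ℚ.* 0ℚ      ≡⟨ sym (cong (π C u' ℚ.*_) (P-distinct cu' cu (u≢u' ∘ sym) s' s)) ⟩
        π C u' ℚ.* P u' u  ∎
        where open ≡-Reasoning

    stationary : ∀ u' → canon u' ≡ true → qsum (map (λ u → π C u ℚ.* P u u') qnodes) ≡ π C u'
    stationary u' cu' = begin
      qsum (map (λ u → π C u ℚ.* P u u') qnodes)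
        ≡⟨ cong qsum (ListP.map-cong-local (All.tabulate λ {u} u∈ →
             detailed-balance u u' (∈qnodes⇒canon u∈) cu')) ⟩
      qsum (map (λ u → π C u' ℚ.* P u' u) qnodes) ≡⟨ ℚΣ.sum-map-*ˡ (π C u') (P u') qnodes ⟩
      π C u' ℚ.* qsum (map (P u') qnodes)         ≡⟨ cong (π C u' ℚ.*_) (row-sum u' cu') ⟩
      π C u' ℚ.* 1ℚ                               ≡⟨ ℚP.*-identityʳ (π C u') ⟩
      π C u'                                      ∎
      where open ≡-Reasoning

theorem1p36 : {n : ℕ} (Γ : DoubleCover n) (C : Fin n → Bool) →
    Quotient.IsComponent Γ C →
      ((∀ u → 0ℚ ≤ Quotient.π Γ C u)
      × qsum (map (Quotient.π Γ C) (Quotient.qnodes Γ)) ≡ 1ℚ)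
      × (∀ u u' → Quotient.canon Γ u ≡ true → Quotient.canon Γ u' ≡ true →
          Quotient.π Γ C u * Quotient.P Γ u u' ≡ Quotient.π Γ C u' * Quotient.P Γ u' u)
      × (∀ u' → Quotient.canon Γ u' ≡ true →
          qsum (map (λ u → Quotient.π Γ C u * Quotient.P Γ u u') (Quotient.qnodes Γ))
            ≡ Quotient.π Γ C u')
theorem1p36 Γ C (C⇒canon , (c₀ , C-c₀) , closed , _) =
  (π-nonNeg , π-sum) , detailed-balance , stationary
  where open Walk.Component Γ C C⇒canon c₀ C-c₀ closed
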